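{- Let $(M;c)$ be a connected modular coloured matroid with $r(M)\ge3$. Then $(M;c)$ is a target if and only if $(M|P;\,c|P)$ is a target for every plane $P$ of $M$.
   Context: A coloured matroid $(M;c)$ is a (finite) matroid $M$ with a function $c$ on $E(M)$. $M$ is modular if $r_M(F)+r_M(F')=r_M(F\cup F')+r_M(F\cap F')$ for all flats $F,F'$. A plane is a rank-three flat. $(M;c)$ is a target if there are flats $\mathrm{cl}_M(\varnothing)=F_0\subseteq F_1\subseteq\dots\subseteq F_k=E(M)$ such that every nonempty set among $F_0$ and the sets $F_{i+1}-F_i$ is monochromatic under $c$. -}

module Defs where

open import Data.Nat using (ℕ; zero; suc; _+_; _≤_; _<_)
open import Data.Fin using (Fin; zero; suc; fromℕ; inject₁)
open import Data.Fin.Subset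
  using (Subset; ⊥; ⊤; ⁅_⁆; _∈_; _∉_; _⊆_; _⊂_; _∪_; _∩_; _─_; ∣_∣)
open import Data.Product using (Σ; _×_; _,_)
open import Relation.Binary.PropositionalEquality using (_≡_)
import Data.Empty

record Matroid (n : ℕ) : Set where
  field
    rank       : Subset n → ℕ
    rank-≤-card : ∀ X → rank X ≤ ∣ X ∣
    rank-mono  : ∀ {X Y} → X ⊆ Y → rank X ≤ rank Y
    rank-submod : ∀ X Y → rank (X ∪ Y) + rank (X ∩ Y) ≤ rank X + rank Y

open Matroid public

module _ {n : ℕ} (M : Matroid n) where

  rankM : ℕ
  rankM = rank M ⊤

  IsFlat : Subset n → Set
  IsFlat F = ∀ e → e ∉ F → rank M F < rank M (F ∪ ⁅ e ⁆)

  IsPlane : Subset n → Set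
  IsPlane P = IsFlat P × rank M P ≡ 3

  IsModular : Set
  IsModular = ∀ F F′ → IsFlat F → IsFlat F′ →
    rank M F + rank M F′ ≡ rank M (F ∪ F′) + rank M (F ∩ F′)

  Independent : Subset n → Set
  Independent X = rank M X ≡ ∣ X ∣

  Dependent : Subset n → Set
  Dependent X = rank M X < ∣ X ∣

  IsCircuit : Subset n → Set
  IsCircuit C = Dependent C × (∀ D → D ⊂ C → Independent D)

  Connected : Set
  Connected = ∀ e f → (e ≡ f → Data.Empty.⊥) →
    Σ (Subset n) λ C → IsCircuit C × e ∈ C × f ∈ C

  -- The restriction M|S to a subset S of the ground set: its rank
  -- function is that of M on subsets of S.  We describe the needed
  -- notions for M|S directly.

  IsFlatIn : Subset n → Subset n → Set
  IsFlatIn S F = F ⊆ S × (∀ e → e ∈ S → e ∉ F → rank M F < rank M (F ∪ ⁅ e ⁆))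

  -- cl_{M|S}(∅) = loops of M lying in S
  LoopsIn : Subset n → Fin n → Set
  LoopsIn S e = e ∈ S × rank M ⁅ e ⁆ ≡ 0

  Monochromatic : {C : Set} → (Fin n → C) → Subset n → Set
  Monochromatic c X = ∀ x y → x ∈ X → y ∈ X → c x ≡ c y

  TargetOn : {C : Set} → (Fin n → C) → Subset n → Set
  TargetOn c S =
    Σ ℕ λ k → Σ (Fin (suc k) → Subset n) λ F →
      (∀ i → IsFlatIn S (F i)) ×
      (∀ e → (e ∈ F zero → LoopsIn S e) × (LoopsIn S e → e ∈ F zero)) ×
      F (fromℕ k) ≡ S ×
      (∀ (i : Fin k) → F (inject₁ i) ⊆ F (suc i)) ×
      Monochromatic c (F zero) ×
      (∀ (i : Fin k) → Monochromatic c (F (suc i) ─ F (inject₁ i)))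

  Target : {C : Set} → (Fin n → C) → Set
  Target c = TargetOn c ⊤

{-# OPTIONS --safe #-}
-- Restricting a target chain to any set P, by intersecting each of its flats with P, gives a
-- target on P.  Conversely, say z ≺ x when c z ≢ c x and every point of the line zx not parallel
-- to z has colour c x.  Since lines have at least three points (by connectedness and modularity),
-- in the target of any plane through z and x, z ≺ x holds exactly when z lies in a lower layer
-- than x; so, plane by plane, ≺ behaves like the order of the layers.  In a flat G choose x
-- maximising the rank of the set of elements of G below x; as y ≺ y′ makes that rank grow,
-- nothing in G lies above x.  Moreover x is not spanned by the elements below it (modularity
-- again), so their closure H is a proper subflat, and every element of G outside H has colour
-- c x.  Recursing on H and appending G gives the chain.  The argument decides colour equality,
-- so c is first replaced by a colouring with values in Fin n that is finer than c and still
-- constant on each stratum of the chosen plane targets.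
module Submission where

open import Defs
open import Data.Nat using (ℕ; _≥_)
open import Data.Fin using (Fin)
open import Data.Fin.Subset using (Subset)
open import Data.Product using (_×_)

open import Level using (Level)
open import Function using (_∘_; id)
open import Data.Nat as ℕ using (zero; suc; _+_; _∸_; _≤_; _<_; _≤?_; _<?_; z≤n; s≤s; z<s)
open import Data.Nat.Properties
open import Data.Fin as Fin using (zero; suc; fromℕ; inject₁; punchIn)
import Data.Fin.Properties as Finₚ
open import Data.Fin.Relation.Unary.Top using (view; ‵fromℕ; ‵inject₁)
open import Data.Fin.Subset
  using (⊥; ⊤; ⁅_⁆; _∈_; _∉_; _⊆_; _⊂_; _∪_; _∩_; _─_; _-_; ∣_∣; Nonempty; Empty; inside; outside)
open import Data.Fin.Subset.Properties
open import Data.Fin.Subset.Induction using (⊂-wellFounded)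
open import Data.Vec using (_∷_; tabulate)
import Data.Vec as Vec
open import Data.Vec.Properties using (lookup∘tabulate; []=⇒lookup; lookup⇒[]=)
open import Data.List using (List; []; _∷_; filter; allFin; cartesianProduct)
open import Data.List.Relation.Unary.All as All using (All; []; _∷_)
open import Data.List.Relation.Unary.All.Properties using (all-filter)
open import Data.List.Relation.Unary.Any using (here; there)
open import Data.List.Membership.Propositional using () renaming (_∈_ to _∈ˡ_)
open import Data.List.Membership.Propositional.Properties
  using (∈-filter⁺; ∈-allFin; ∈-cartesianProduct⁺)
open import Data.List.Extrema.Nat using (argmax; argmax-all; f[xs]≤f[argmax])
open import Data.Product using (Σ-syntax; ∃; _,_; proj₁; proj₂)
open import Data.Sum using (_⊎_; inj₁; inj₂; [_,_]′)
import Data.Empty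
open import Induction.WellFounded using (Acc; acc)
open import Relation.Nullary using (¬_; Dec; yes; no; does; contradiction)
open import Relation.Nullary.Decidable using (dec-true; decidable-stable; map′; ¬?; _×-dec_; _→-dec_)
open import Relation.Unary using (Pred; Decidable)
open import Relation.Binary.Definitions using (DecidableEquality; Tri; tri<; tri≈; tri>)
open import Relation.Binary.PropositionalEquality
  using (_≡_; _≢_; refl; sym; trans; cong; cong₂; subst; subst₂; module ≡-Reasoning)

private
  variable
    ℓ : Level
    n k : ℕ
    p q s t : Subset n

x∈p─q⁻ : ∀ {x : Fin n} (p q : Subset n) → x ∈ p ─ q → x ∈ p × x ∉ q
x∈p─q⁻ {x = zero}  (s ∷ p) (inside  ∷ q) ()
x∈p─q⁻ {x = zero}  (s ∷ p) (outside ∷ q) Vec.here = Vec.here , λ ()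
x∈p─q⁻ {x = suc x} (s ∷ p) (t ∷ q) (Vec.there x∈p─q) with x∈p─q⁻ p q x∈p─q
... | x∈p , x∉q = Vec.there x∈p , λ { (Vec.there x∈q) → x∉q x∈q }

∣p∣≡1+∣p-x∣ : ∀ (p : Subset n) x → x ∈ p → ∣ p ∣ ≡ suc ∣ p - x ∣
∣p∣≡1+∣p-x∣ (inside  ∷ p) zero    Vec.here       = cong (suc ∘ ∣_∣) (sym (p─⊥≡p p))
∣p∣≡1+∣p-x∣ (outside ∷ p) (suc x) (Vec.there x∈p) = ∣p∣≡1+∣p-x∣ p x x∈p
∣p∣≡1+∣p-x∣ (inside  ∷ p) (suc x) (Vec.there x∈p) = cong suc (∣p∣≡1+∣p-x∣ p x x∈p)

∪-least : p ⊆ s → q ⊆ s → p ∪ q ⊆ s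
∪-least {p = p} {q = q} p⊆s q⊆s x∈p∪q = [ p⊆s , q⊆s ]′ (x∈p∪q⁻ p q x∈p∪q)

∪-mono : p ⊆ s → q ⊆ t → p ∪ q ⊆ s ∪ t
∪-mono {s = s} {t = t} p⊆s q⊆t = ∪-least (p⊆p∪q t ∘ p⊆s) (q⊆p∪q s t ∘ q⊆t)

∩-─-⊆ : (p ∩ s) ─ (q ∩ s) ⊆ p ─ q
∩-─-⊆ {p = p} {s = s} {q = q} x∈ with x∈p─q⁻ (p ∩ s) (q ∩ s) x∈
... | x∈p∩s , x∉q∩s =
  x∈p∧x∉q⇒x∈p─q (p∩q⊆p p s x∈p∩s) (λ x∈q → x∉q∩s (x∈p∩q⁺ (x∈q , p∩q⊆q p s x∈p∩s)))

⁅x⁆⊆ : ∀ {x : Fin n} {p} → x ∈ p → ⁅ x ⁆ ⊆ p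
⁅x⁆⊆ {p = p} x∈p y∈⁅x⁆ = subst (_∈ p) (sym (x∈⁅y⁆⇒x≡y _ y∈⁅x⁆)) x∈p

p⊆[p-x]∪⁅x⁆ : ∀ (p : Subset n) x → p ⊆ (p - x) ∪ ⁅ x ⁆
p⊆[p-x]∪⁅x⁆ p x {y} y∈p with y Fin.≟ x
... | yes refl = q⊆p∪q (p - x) ⁅ x ⁆ (x∈⁅x⁆ x)
... | no  y≢x  = p⊆p∪q ⁅ x ⁆ (x∈p∧x≢y⇒x∈p-y y∈p y≢x)

x∉p-x : ∀ (p : Subset n) x → x ∉ p - x
x∉p-x p x x∈p-x = proj₂ (x∈p─q⁻ p ⁅ x ⁆ x∈p-x) (x∈⁅x⁆ x)

pair : Fin n → Fin n → Subset n
pair x y = ⁅ x ⁆ ∪ ⁅ y ⁆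

pair⊆ : ∀ {x y : Fin n} {p} → x ∈ p → y ∈ p → pair x y ⊆ p
pair⊆ x∈p y∈p = ∪-least (⁅x⁆⊆ x∈p) (⁅x⁆⊆ y∈p)

select : {P : Pred (Fin n) ℓ} → Decidable P → Subset n
select P? = tabulate (does ∘ P?)

module _ {P : Pred (Fin n) ℓ} (P? : Decidable P) {x : Fin n} where

  ∈-select⁺ : P x → x ∈ select P?
  ∈-select⁺ px = lookup⇒[]= x _ (trans (lookup∘tabulate (does ∘ P?) x) (dec-true (P? x) px))

  ∈-select⁻ : x ∈ select P? → P x
  ∈-select⁻ x∈ with P? x | trans (sym (lookup∘tabulate (does ∘ P?) x)) ([]=⇒lookup x∈)
  ... | yes px | _  = px
  ... | no  _  | ()

removal-induction : (P : Subset n → Set ℓ) →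
  (∀ {p} → Empty p → P p) → (∀ {p x} → x ∈ p → P (p - x) → P p) → ∀ p → P p
removal-induction P base step p = go p (⊂-wellFounded p)
  where
  go : ∀ p → Acc _⊂_ p → P p
  go p (acc smaller) with nonempty? p
  ... | no  p-empty   = base p-empty
  ... | yes (x , x∈p) = step x∈p (go (p - x) (smaller (x∈p⇒p-x⊂p x∈p)))

another : 2 ≤ n → (e : Fin n) → ∃ λ f → e ≢ f
another {n = suc zero}    (s≤s ()) _
another {n = suc (suc _)} _ e = punchIn e zero , λ e≡f → Finₚ.punchInᵢ≢i e zero (sym e≡f)

least : {Q : Pred (Fin (suc k)) ℓ} → Decidable Q → Fin (suc k)
least {k = zero}  Q? = zero
least {k = suc k} Q? with Q? zero
... | yes _ = zero
... | no  _ = suc (least (Q? ∘ suc))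

least-satisfies : {Q : Pred (Fin (suc k)) ℓ} (Q? : Decidable Q) → ∀ {i} → Q i → Q (least Q?)
least-satisfies {k = zero}  Q? {zero} q = q
least-satisfies {k = suc k} Q? {i}    q with Q? zero | i
... | yes q₀ | _     = q₀
... | no ¬q₀ | zero  = contradiction q ¬q₀
... | no _   | suc i = least-satisfies (Q? ∘ suc) q

least-minimal : {Q : Pred (Fin (suc k)) ℓ} (Q? : Decidable Q) → ∀ {i} → Q i → least Q? Fin.≤ i
least-minimal {k = zero}  Q? {zero} q = z≤n
least-minimal {k = suc k} Q? {i}    q with Q? zero | i
... | yes _  | _     = z≤n
... | no ¬q₀ | zero  = contradiction q ¬q₀
... | no _   | suc i = s≤s (least-minimal (Q? ∘ suc) q)

snoc : ∀ {A : Set ℓ} → (Fin (suc k) → A) → A → Fin (suc (suc k)) → A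
snoc             f a zero       = f zero
snoc {k = zero}  f a (suc zero) = a
snoc {k = suc k} f a (suc i)    = snoc (f ∘ suc) a i

snoc-inject₁ : ∀ {A : Set ℓ} (f : Fin (suc k) → A) a i → snoc f a (inject₁ i) ≡ f i
snoc-inject₁             f a zero    = refl
snoc-inject₁ {k = suc k} f a (suc i) = snoc-inject₁ (f ∘ suc) a i

snoc-last : ∀ {A : Set ℓ} (f : Fin (suc k) → A) a → snoc f a (fromℕ (suc k)) ≡ a
snoc-last {k = zero}  f a = refl
snoc-last {k = suc k} f a = snoc-last (f ∘ suc) a

chain-mono : (F : Fin (suc k) → Subset n) → (∀ i → F (inject₁ i) ⊆ F (suc i)) →
  ∀ {i j} → i Fin.≤ j → F i ⊆ F j
chain-mono             F steps {zero}  {zero}  _         = id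
chain-mono {k = suc k} F steps {zero}  {suc j} _         =
  chain-mono (F ∘ suc) (steps ∘ suc) {zero} {j} z≤n ∘ steps zero
chain-mono {k = suc k} F steps {suc i} {suc j} (s≤s i≤j) =
  chain-mono (F ∘ suc) (steps ∘ suc) i≤j

-- Refining a colouring

FinerThan : ∀ {A D C : Set} → (A → D) → (A → C) → Set
FinerThan f c = ∀ {x y} → f x ≡ f y → c x ≡ c y

module _ {A D C : Set} (_≟_ : DecidableEquality D) (c : A → C) where

  merge : (A → D) → A → A → A → D
  merge f x y z with f z ≟ f x
  ... | yes _ = f y
  ... | no  _ = f z

  merge-finer : ∀ {f x y} → FinerThan f c → c x ≡ c y → FinerThan (merge f x y) c
  merge-finer {f} {x} {y} f-finer cx≡cy {z} {w} eq with f z ≟ f x | f w ≟ f x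
  ... | yes z~x | yes w~x = trans (f-finer z~x) (sym (f-finer w~x))
  ... | yes z~x | no  _   = trans (f-finer z~x) (trans cx≡cy (f-finer eq))
  ... | no  _   | yes w~x = trans (f-finer eq) (trans (sym cx≡cy) (sym (f-finer w~x)))
  ... | no  _   | no  _   = f-finer eq

  merge-preserves : ∀ {f x y z w} → f z ≡ f w → merge f x y z ≡ merge f x y w
  merge-preserves {f} {x} {y} {z} {w} eq with f z ≟ f x | f w ≟ f x
  ... | yes _   | yes _   = refl
  ... | yes z~x | no  w≁x = contradiction (trans (sym eq) z~x) w≁x
  ... | no  z≁x | yes w~x = contradiction (trans eq w~x) z≁x
  ... | no  _   | no  _   = eq

  merge-joins : ∀ f x y → merge f x y x ≡ merge f x y y
  merge-joins f x y with f x ≟ f x | f y ≟ f x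
  ... | yes _ | yes _ = refl
  ... | yes _ | no  _ = refl
  ... | no x≁x | _    = contradiction refl x≁x

  mergeAll : List (A × A) → (A → D) → A → D
  mergeAll []             f = f
  mergeAll ((x , y) ∷ ps) f = mergeAll ps (merge f x y)

  mergeAll-finer : ∀ {ps f} → All (λ (x , y) → c x ≡ c y) ps → FinerThan f c →
    FinerThan (mergeAll ps f) c
  mergeAll-finer []           f-finer = f-finer
  mergeAll-finer (cx≡cy ∷ ps) f-finer = mergeAll-finer ps (merge-finer f-finer cx≡cy)

  mergeAll-preserves : ∀ ps {f z w} → f z ≡ f w → mergeAll ps f z ≡ mergeAll ps f w
  mergeAll-preserves []             eq = eq
  mergeAll-preserves ((x , y) ∷ ps) eq = mergeAll-preserves ps (merge-preserves eq)

  mergeAll-joins : ∀ {ps f x y} → (x , y) ∈ˡ ps → mergeAll ps f x ≡ mergeAll ps f y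
  mergeAll-joins {_ ∷ ps} {f} {x} {y} (here refl)   = mergeAll-preserves ps (merge-joins f x y)
  mergeAll-joins {_ ∷ ps}              (there xy∈ps) = mergeAll-joins xy∈ps

refinement-between : ∀ {C : Set} (c : Fin n → C) (R : Fin n → Fin n → Set) →
  (∀ x y → Dec (R x y)) → (∀ {x y} → R x y → c x ≡ c y) →
  Σ[ d ∈ (Fin n → Fin n) ] FinerThan d c × (∀ {x y} → R x y → d x ≡ d y)
refinement-between {n = n} c R R? R⇒≡ =
  mergeAll Finₚ._≟_ c related id ,
  mergeAll-finer Finₚ._≟_ c (All.map R⇒≡ (all-filter R?′ allPairs)) (cong c) ,
  λ xRy → mergeAll-joins Finₚ._≟_ c (∈-filter⁺ R?′ (∈-cartesianProduct⁺ (∈-allFin _) (∈-allFin _)) xRy)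
  where
  R?′ : Decidable (λ ((x , y) : Fin n × Fin n) → R x y)
  R?′ (x , y) = R? x y

  allPairs : List (Fin n × Fin n)
  allPairs = cartesianProduct (allFin n) (allFin n)

  related : List (Fin n × Fin n)
  related = filter R?′ allPairs

-- Rank, closure and flats

module MatroidTheory {n : ℕ} (M : Matroid n) where

  r : Subset n → ℕ
  r = rank M

  rank-empty : ∀ {X} → Empty X → r X ≡ 0
  rank-empty {X} empty = n≤0⇒n≡0 (begin
    r X       ≤⟨ rank-≤-card M X ⟩
    ∣ X ∣     ≡⟨ cong ∣_∣ (Empty-unique empty) ⟩
    ∣ ⊥ {n} ∣ ≡⟨ ∣⊥∣≡0 n ⟩
    0         ∎)
    where open ≤-Reasoning

  rank-⁅⁆≤1 : ∀ e → r ⁅ e ⁆ ≤ 1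
  rank-⁅⁆≤1 e = subst (r ⁅ e ⁆ ≤_) (∣⁅x⁆∣≡1 e) (rank-≤-card M ⁅ e ⁆)

  rank-insert : ∀ X e → r (X ∪ ⁅ e ⁆) ≤ suc (r X)
  rank-insert X e = begin
    r (X ∪ ⁅ e ⁆)                 ≤⟨ m≤m+n _ _ ⟩
    r (X ∪ ⁅ e ⁆) + r (X ∩ ⁅ e ⁆) ≤⟨ rank-submod M X ⁅ e ⁆ ⟩
    r X + r ⁅ e ⁆                 ≤⟨ +-monoʳ-≤ (r X) (rank-⁅⁆≤1 e) ⟩
    r X + 1                       ≡⟨ +-comm (r X) 1 ⟩
    suc (r X)                     ∎
    where open ≤-Reasoning

  infix 4 _spans_ _spans?_
  _spans_ : Subset n → Fin n → Set
  X spans e = r (X ∪ ⁅ e ⁆) ≤ r X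

  _spans?_ : ∀ X e → Dec (X spans e)
  X spans? e = r (X ∪ ⁅ e ⁆) ≤? r X

  ∈⇒spans : ∀ {X e} → e ∈ X → X spans e
  ∈⇒spans e∈X = rank-mono M (∪-least id (⁅x⁆⊆ e∈X))

  spans-mono : ∀ {X Y e} → X ⊆ Y → X spans e → Y spans e
  spans-mono {X} {Y} {e} X⊆Y X-spans = +-cancelʳ-≤ (r X) _ _ (begin
    r (Y ∪ ⁅ e ⁆) + r X                       ≤⟨ +-mono-≤ (rank-mono M ∪-side) (rank-mono M ∩-side) ⟩
    r (Y ∪ (X ∪ ⁅ e ⁆)) + r (Y ∩ (X ∪ ⁅ e ⁆)) ≤⟨ rank-submod M Y (X ∪ ⁅ e ⁆) ⟩
    r Y + r (X ∪ ⁅ e ⁆)                       ≤⟨ +-monoʳ-≤ (r Y) X-spans ⟩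
    r Y + r X                                 ∎)
    where
    open ≤-Reasoning

    ∪-side : Y ∪ ⁅ e ⁆ ⊆ Y ∪ (X ∪ ⁅ e ⁆)
    ∪-side = ∪-mono id (q⊆p∪q X ⁅ e ⁆)

    ∩-side : X ⊆ Y ∩ (X ∪ ⁅ e ⁆)
    ∩-side x∈X = x∈p∩q⁺ (X⊆Y x∈X , p⊆p∪q ⁅ e ⁆ x∈X)

  spans-all : ∀ X Y → (∀ {y} → y ∈ Y → X spans y) → r (X ∪ Y) ≤ r X
  spans-all X = removal-induction (λ Y → (∀ {y} → y ∈ Y → X spans y) → r (X ∪ Y) ≤ r X) base step
    where
    base : ∀ {Y} → Empty Y → (∀ {y} → y ∈ Y → X spans y) → r (X ∪ Y) ≤ r X
    base empty _ = rank-mono M (∪-least id (λ {y} y∈Y → contradiction (y , y∈Y) empty))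

    step : ∀ {Y z} → z ∈ Y → ((∀ {y} → y ∈ Y - z → X spans y) → r (X ∪ (Y - z)) ≤ r X) →
           (∀ {y} → y ∈ Y → X spans y) → r (X ∪ Y) ≤ r X
    step {Y} {z} z∈Y ih spanned = begin
      r (X ∪ Y)                   ≤⟨ rank-mono M (∪-least (p⊆p∪q _ ∘ p⊆p∪q _)
                                                          (∪-mono (q⊆p∪q X _) id ∘ p⊆[p-x]∪⁅x⁆ Y z)) ⟩
      r ((X ∪ (Y - z)) ∪ ⁅ z ⁆)   ≤⟨ spans-mono (p⊆p∪q (Y - z)) (spanned z∈Y) ⟩
      r (X ∪ (Y - z))             ≤⟨ ih (spanned ∘ p─q⊆p Y ⁅ z ⁆) ⟩
      r X                         ∎
      where open ≤-Reasoning

  ClosedAt : Subset n → Fin n → Set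
  ClosedAt F e = e ∉ F → r F < r (F ∪ ⁅ e ⁆)

  spans⇒∈ : ∀ {F X e} → ClosedAt F e → X ⊆ F → X spans e → e ∈ F
  spans⇒∈ {F} {e = e} closed X⊆F X-spans with e ∈? F
  ... | yes e∈F = e∈F
  ... | no  e∉F = contradiction (spans-mono X⊆F X-spans) (<⇒≱ (closed e∉F))

  cl : Subset n → Subset n
  cl X = select (X spans?_)

  ∈cl⁺ : ∀ {X e} → X spans e → e ∈ cl X
  ∈cl⁺ {X} = ∈-select⁺ (X spans?_)

  ∈cl⁻ : ∀ {X e} → e ∈ cl X → X spans e
  ∈cl⁻ {X} = ∈-select⁻ (X spans?_)

  ⊆cl : ∀ {X} → X ⊆ cl X
  ⊆cl = ∈cl⁺ ∘ ∈⇒spans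

  rank-cl : ∀ X → r (cl X) ≡ r X
  rank-cl X =
    ≤-antisym (≤-trans (rank-mono M (q⊆p∪q X (cl X))) (spans-all X (cl X) ∈cl⁻)) (rank-mono M ⊆cl)

  cl-isFlat : ∀ X → IsFlat M (cl X)
  cl-isFlat X e e∉cl = ≰⇒> λ cl-spans → e∉cl (∈cl⁺ (begin
    r (X ∪ ⁅ e ⁆)    ≤⟨ rank-mono M (∪-mono ⊆cl id) ⟩
    r (cl X ∪ ⁅ e ⁆) ≤⟨ cl-spans ⟩
    r (cl X)         ≡⟨ rank-cl X ⟩
    r X              ∎))
    where open ≤-Reasoning

  cl-minimal : ∀ {F X} → IsFlat M F → X ⊆ F → cl X ⊆ F
  cl-minimal flat X⊆F e∈cl = spans⇒∈ (flat _) X⊆F (∈cl⁻ e∈cl)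

  cl-mono : ∀ {X Y} → X ⊆ Y → cl X ⊆ cl Y
  cl-mono X⊆Y = ∈cl⁺ ∘ spans-mono X⊆Y ∘ ∈cl⁻

  loop∈flat : ∀ {F e} → IsFlat M F → r ⁅ e ⁆ ≡ 0 → e ∈ F
  loop∈flat {e = e} flat loop = spans⇒∈ (flat e) (λ x∈⊥ → contradiction x∈⊥ ∉⊥) (begin
    r (⊥ ∪ ⁅ e ⁆) ≡⟨ cong r (∪-identityˡ ⁅ e ⁆) ⟩
    r ⁅ e ⁆       ≡⟨ loop ⟩
    0             ≤⟨ z≤n ⟩
    r ⊥           ∎)
    where open ≤-Reasoning

  ∩-isFlatIn : ∀ {F} P → IsFlat M F → IsFlatIn M P (F ∩ P)
  ∩-isFlatIn {F} P flat = p∩q⊆q F P , λ e e∈P e∉F∩P →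
    ≰⇒> (λ spans → e∉F∩P (x∈p∩q⁺ (spans⇒∈ (flat e) (p∩q⊆p F P) spans , e∈P)))

  isFlatIn⊤⇒isFlat : ∀ {F} → IsFlatIn M ⊤ F → IsFlat M F
  isFlatIn⊤⇒isFlat (_ , closed) e = closed e ∈⊤

  isFlat⇒isFlatIn : ∀ {F S} → IsFlat M F → F ⊆ S → IsFlatIn M S F
  isFlat⇒isFlatIn flat F⊆S = F⊆S , λ e _ → flat e

  isFlatIn-isFlat⇒isFlat : ∀ {F H} → IsFlat M H → IsFlatIn M H F → IsFlat M F
  isFlatIn-isFlat⇒isFlat {F} {H} flatH (F⊆H , closedInH) e e∉F with e ∈? H
  ... | yes e∈H = closedInH e e∈H e∉F
  ... | no  e∉H = ≰⇒> (λ spans → e∉H (spans⇒∈ (flatH e) F⊆H spans))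

  infix 4 _∥_ _∥?_
  _∥_ : Fin n → Fin n → Set
  x ∥ y = r (pair x y) ≤ 1

  _∥?_ : ∀ x y → Dec (x ∥ y)
  x ∥? y = r (pair x y) ≤? 1

  ∥-sym : ∀ {x y} → x ∥ y → y ∥ x
  ∥-sym {x} {y} = subst (λ p → r p ≤ 1) (∪-comm ⁅ x ⁆ ⁅ y ⁆)

  ∦⇒≢ : ∀ {x y} → ¬ x ∥ y → x ≢ y
  ∦⇒≢ {x} x∦x refl = x∦x (≤-trans (rank-mono M (∪-least id id)) (rank-⁅⁆≤1 x))

  line : Fin n → Fin n → Subset n
  line x y = cl (pair x y)

  line-comm : ∀ x y → line x y ≡ line y x
  line-comm x y = cong cl (∪-comm ⁅ x ⁆ ⁅ y ⁆)

  ∦⇒2≤rank-line : ∀ {x y} → ¬ x ∥ y → 2 ≤ r (line x y)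
  ∦⇒2≤rank-line {x} {y} x∦y = subst (2 ≤_) (sym (rank-cl (pair x y))) (≰⇒> x∦y)

  line-exchange : ∀ {x y u} → u ∈ line x y → ¬ x ∥ u → y ∈ line x u
  line-exchange {x} {y} {u} u∈xy x∦u = ∈cl⁺ (begin
    r (pair x u ∪ ⁅ y ⁆) ≤⟨ rank-mono M (∪-least (∪-mono (p⊆p∪q ⁅ y ⁆) id)
                                                  (p⊆p∪q _ ∘ q⊆p∪q ⁅ x ⁆ ⁅ y ⁆)) ⟩
    r (pair x y ∪ ⁅ u ⁆) ≤⟨ ∈cl⁻ u∈xy ⟩
    r (pair x y)         ≤⟨ rank-insert ⁅ x ⁆ y ⟩
    suc (r ⁅ x ⁆)        ≤⟨ s≤s (rank-⁅⁆≤1 x) ⟩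
    2                    ≤⟨ ≰⇒> x∦u ⟩
    r (pair x u)         ∎)
    where open ≤-Reasoning

  modular-meet : IsModular M → ∀ {A B} → IsFlat M A → IsFlat M B →
    r (A ∪ B) < r A + r B → Nonempty (A ∩ B)
  modular-meet modular {A} {B} flatA flatB <sum with nonempty? (A ∩ B)
  ... | yes meet  = meet
  ... | no  empty = contradiction (begin
    r A + r B               ≡⟨ modular A B flatA flatB ⟩
    r (A ∪ B) + r (A ∩ B)   ≡⟨ cong (r (A ∪ B) +_) (rank-empty empty) ⟩
    r (A ∪ B) + 0           ≡⟨ +-identityʳ _ ⟩
    r (A ∪ B)               ∎) (<⇒≱ <sum ∘ ≤-reflexive)
    where open ≡-Reasoning

  line-meets-cl-rest : IsModular M → ∀ {Y x z} → x ∈ cl Y → z ∈ Y → ¬ x ∥ z →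
    Nonempty (cl (Y - z) ∩ line x z)
  line-meets-cl-rest modular {Y} {x} {z} x∈clY z∈Y x∦z =
    modular-meet modular (cl-isFlat _) (cl-isFlat _) (begin-strict
    r (cl (Y - z) ∪ line x z)        ≤⟨ rank-mono M (∪-least (cl-mono (p─q⊆p Y ⁅ z ⁆)) line⊆clY) ⟩
    r (cl Y)                         ≡⟨ rank-cl Y ⟩
    r Y                              ≤⟨ rank-mono M (p⊆[p-x]∪⁅x⁆ Y z) ⟩
    r ((Y - z) ∪ ⁅ z ⁆)              ≤⟨ rank-insert (Y - z) z ⟩
    suc (r (Y - z))                  <⟨ n<1+n _ ⟩
    2 + r (Y - z)                    ≡⟨ +-comm 2 _ ⟩
    r (Y - z) + 2                    ≤⟨ +-mono-≤ (≤-reflexive (sym (rank-cl _))) (∦⇒2≤rank-line x∦z) ⟩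
    r (cl (Y - z)) + r (line x z)    ∎)
    where
    open ≤-Reasoning

    line⊆clY : line x z ⊆ cl Y
    line⊆clY = cl-minimal (cl-isFlat Y) (pair⊆ x∈clY (⊆cl z∈Y))

  module _ {C x y} (circuit : IsCircuit M C) (x∈C : x ∈ C) (y∈C : y ∈ C) (x≢y : x ≢ y) where

    private
      dependent : Dependent M C
      dependent = proj₁ circuit

      minimal : ∀ D → D ⊂ C → Independent M D
      minimal = proj₂ circuit

      x∈C-y : x ∈ C - y
      x∈C-y = x∈p∧x≢y⇒x∈p-y x∈C x≢y

      rank-C-y-x : r (C - y - x) ≡ ∣ C - y - x ∣
      rank-C-y-x = minimal (C - y - x)
        (p─q⊆p C ⁅ y ⁆ ∘ p─q⊆p (C - y) ⁅ x ⁆ , y , y∈C , x∉p-x C y ∘ p─q⊆p (C - y) ⁅ x ⁆)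

      ∣C-y∣ : ∣ C - y ∣ ≡ suc ∣ C - y - x ∣
      ∣C-y∣ = ∣p∣≡1+∣p-x∣ (C - y) x x∈C-y

    circuit-rank≤ : r C ≤ suc (r (C - y - x))
    circuit-rank≤ = ≤-pred (begin-strict
      r C                       <⟨ dependent ⟩
      ∣ C ∣                     ≡⟨ trans (∣p∣≡1+∣p-x∣ C y y∈C) (cong suc ∣C-y∣) ⟩
      suc (suc ∣ C - y - x ∣)   ≡⟨ cong (2 +_) (sym rank-C-y-x) ⟩
      suc (suc (r (C - y - x))) ∎)
      where open ≤-Reasoning

    circuit-¬spans : ¬ (C - y - x) spans x
    circuit-¬spans spans = <⇒≱ (begin-strict
      r (C - y - x)           ≡⟨ rank-C-y-x ⟩
      ∣ C - y - x ∣           <⟨ ≤-refl ⟩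
      suc ∣ C - y - x ∣       ≡⟨ sym ∣C-y∣ ⟩
      ∣ C - y ∣               ≡⟨ sym (minimal (C - y) (p─q⊆p C ⁅ y ⁆ , y , y∈C , x∉p-x C y)) ⟩
      r (C - y)               ∎) (begin
      r (C - y)               ≤⟨ rank-mono M (p⊆[p-x]∪⁅x⁆ (C - y) x) ⟩
      r ((C - y - x) ∪ ⁅ x ⁆) ≤⟨ spans ⟩
      r (C - y - x)           ∎)
      where open ≤-Reasoning

  ∃¬spans : ∀ {X} → r X < r ⊤ → ∃ λ e → ¬ X spans e
  ∃¬spans {X} X<⊤ with Finₚ.all? (X spans?_)
  ... | yes all =
    contradiction (≤-trans (rank-mono M (q⊆p∪q X ⊤)) (spans-all X ⊤ (λ {y} _ → all y))) (<⇒≱ X<⊤)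
  ... | no ¬all = Finₚ.¬∀⟶∃¬ n _ (X spans?_) ¬all

  flat-extension : ∀ {k} X → r X ≤ k → k ≤ r ⊤ → Σ[ F ∈ Subset n ] IsFlat M F × r F ≡ k × X ⊆ F
  flat-extension {k} X X≤k k≤⊤ = go (k ∸ r X) X (m+[n∸m]≡n X≤k)
    where
    go : ∀ d X → r X + d ≡ k → Σ[ F ∈ Subset n ] IsFlat M F × r F ≡ k × X ⊆ F
    go zero    X eq = cl X , cl-isFlat X , trans (rank-cl X) (trans (sym (+-identityʳ _)) eq) , ⊆cl
    go (suc d) X eq =
      let e , ¬spans = ∃¬spans (<-≤-trans (subst (r X <_) eq (m<m+n (r X) z<s)) k≤⊤)
          rank-X∪e   = ≤-antisym (rank-insert X e) (≰⇒> ¬spans)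
          F , flat , rank-F , X∪e⊆F =
            go d (X ∪ ⁅ e ⁆) (trans (cong (_+ d) rank-X∪e) (trans (sym (+-suc (r X) d)) eq))
      in F , flat , rank-F , X∪e⊆F ∘ p⊆p∪q ⁅ e ⁆

  plane-through : 3 ≤ r ⊤ → ∀ x y z → Σ[ P ∈ Subset n ] IsPlane M P × x ∈ P × y ∈ P × z ∈ P
  plane-through 3≤⊤ x y z =
    let P , flat , rank-P , xyz⊆P = flat-extension (pair x y ∪ ⁅ z ⁆) rank≤3 3≤⊤
    in P , (flat , rank-P) , xyz⊆P (p⊆p∪q _ (p⊆p∪q _ (x∈⁅x⁆ x))) ,
       xyz⊆P (p⊆p∪q _ (q⊆p∪q ⁅ x ⁆ _ (x∈⁅x⁆ y))) , xyz⊆P (q⊆p∪q (pair x y) _ (x∈⁅x⁆ z))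
    where
    rank≤3 : r (pair x y ∪ ⁅ z ⁆) ≤ 3
    rank≤3 = ≤-trans (rank-insert (pair x y) z) (s≤s (≤-trans (rank-insert ⁅ x ⁆ y) (s≤s (rank-⁅⁆≤1 x))))

  connected⇒loopless : 2 ≤ n → Connected M → ∀ e → r ⁅ e ⁆ ≡ 1
  connected⇒loopless 2≤n connected e with another 2≤n e
  ... | f , e≢f with connected e f e≢f
  ...   | C , (_ , minimal) , e∈C , f∈C =
    trans (minimal ⁅ e ⁆ (⁅x⁆⊆ e∈C , f , f∈C , e≢f ∘ sym ∘ x∈⁅y⁆⇒x≡y e)) (∣⁅x⁆∣≡1 e)

  module Loopless (loopless : ∀ e → r ⁅ e ⁆ ≡ 1) where

    ∥⇒spans : ∀ {x y} → x ∥ y → ⁅ x ⁆ spans y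
    ∥⇒spans {x} {y} = subst (r (pair x y) ≤_) (sym (loopless x))

    ∥-closed : ∀ {F x y} → IsFlat M F → x ∈ F → x ∥ y → y ∈ F
    ∥-closed flat x∈F x∥y = spans⇒∈ (flat _) (⁅x⁆⊆ x∈F) (∥⇒spans x∥y)

    empty-¬spans : ∀ {X e} → Empty X → ¬ X spans e
    empty-¬spans {X} {e} empty spans = contradiction (begin
      1             ≡⟨ sym (loopless e) ⟩
      r ⁅ e ⁆       ≤⟨ rank-mono M (q⊆p∪q X ⁅ e ⁆) ⟩
      r (X ∪ ⁅ e ⁆) ≤⟨ spans ⟩
      r X           ≡⟨ rank-empty empty ⟩
      0             ∎) λ ()
      where open ≤-Reasoning

    -- Modularity puts a point of the line xy into the span of the rest of a circuit through x and y.
    lines-have-three-points : Connected M → IsModular M →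
      ∀ {x y} → ¬ x ∥ y → ∃ λ u → u ∈ line x y × ¬ x ∥ u × ¬ y ∥ u
    lines-have-three-points connected modular {x} {y} x∦y with connected x y (∦⇒≢ x∦y)
    ... | C , circuit , x∈C , y∈C = u , p∩q⊆p _ _ u∈meet , x∦u , y∦u
      where
      X : Subset n
      X = C - y - x

      X⊆C : X ⊆ C
      X⊆C = p─q⊆p C ⁅ y ⁆ ∘ p─q⊆p (C - y) ⁅ x ⁆

      X-¬spans-x : ¬ X spans x
      X-¬spans-x = circuit-¬spans circuit x∈C y∈C (∦⇒≢ x∦y)

      X-¬spans-y : ¬ X spans y
      X-¬spans-y = subst (λ X → ¬ X spans y) (p─x─y≡p─y─x C x y)
                         (circuit-¬spans circuit y∈C x∈C (∦⇒≢ x∦y ∘ sym))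

      meet : Nonempty (line x y ∩ cl X)
      meet = modular-meet modular (cl-isFlat _) (cl-isFlat X) (begin-strict
        r (line x y ∪ cl X)    ≤⟨ rank-mono M (∪-least (cl-mono (pair⊆ x∈C y∈C)) (cl-mono X⊆C)) ⟩
        r (cl C)               ≡⟨ rank-cl C ⟩
        r C                    ≤⟨ circuit-rank≤ circuit x∈C y∈C (∦⇒≢ x∦y) ⟩
        suc (r X)              <⟨ ≤-refl ⟩
        2 + r X                ≤⟨ +-mono-≤ (∦⇒2≤rank-line x∦y) (≤-reflexive (sym (rank-cl X))) ⟩
        r (line x y) + r (cl X) ∎)
        where open ≤-Reasoning

      u : Fin n
      u = proj₁ meet

      u∈meet : u ∈ line x y ∩ cl X
      u∈meet = proj₂ meet

      ∦u : ∀ {v} → ¬ X spans v → ¬ v ∥ u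
      ∦u ¬spans v∥u = ¬spans (∈cl⁻ (∥-closed (cl-isFlat X) (p∩q⊆q _ _ u∈meet) (∥-sym v∥u)))

      x∦u : ¬ x ∥ u
      x∦u = ∦u X-¬spans-x

      y∦u : ¬ y ∥ u
      y∦u = ∦u X-¬spans-y

-- Targets

stratum : (Fin (suc k) → Subset n) → Fin (suc k) → Subset n
stratum F zero    = F zero
stratum F (suc i) = F (suc i) ─ F (inject₁ i)

module Targets {n : ℕ} (M : Matroid n) where
  open MatroidTheory M

  module _ {C : Set} {c : Fin n → C} {P : Subset n} where

    chain : (W : TargetOn M c P) → Fin (suc (proj₁ W)) → Subset n
    chain W = proj₁ (proj₂ W)

    strata-monochromatic : (W : TargetOn M c P) → ∀ i → Monochromatic M c (stratum (chain W) i)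
    strata-monochromatic (_ , _ , _ , _ , _ , _ , mono₀ , _)     zero    = mono₀
    strata-monochromatic (_ , _ , _ , _ , _ , _ , _     , monoₛ) (suc i) = monoₛ i

    SameStratum : TargetOn M c P → Fin n → Fin n → Set
    SameStratum W x y = ∃ λ i → x ∈ stratum (chain W) i × y ∈ stratum (chain W) i

    sameStratum? : ∀ W x y → Dec (SameStratum W x y)
    sameStratum? W x y = Finₚ.any? λ i → (x ∈? stratum (chain W) i) ×-dec (y ∈? stratum (chain W) i)

    recolour : ∀ {D} {d : Fin n → D} (W : TargetOn M c P) →
      (∀ i → Monochromatic M d (stratum (chain W) i)) → TargetOn M d P
    recolour (k , F , flats , loops , top , steps , _) mono =
      k , F , flats , loops , top , steps , mono zero , mono ∘ suc

  TargetOn-coarsen : ∀ {C D} {c : Fin n → C} {d : Fin n → D} {P} →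
    FinerThan d c → TargetOn M d P → TargetOn M c P
  TargetOn-coarsen d-finer W = recolour W (λ i x y x∈ y∈ → d-finer (strata-monochromatic W i x y x∈ y∈))

  module _ {C : Set} (c : Fin n → C) where

    Monochromatic-⊆ : ∀ {X Y} → X ⊆ Y → Monochromatic M c Y → Monochromatic M c X
    Monochromatic-⊆ X⊆Y mono x y x∈X y∈X = mono x y (X⊆Y x∈X) (X⊆Y y∈X)

    Target⇒TargetOn : Target M c → ∀ P → TargetOn M c P
    Target⇒TargetOn (k , F , flats , loops , top , steps , mono₀ , monoₛ) P =
      k , (λ i → F i ∩ P) , (λ i → ∩-isFlatIn P (isFlatIn⊤⇒isFlat (flats i))) , loops∩P ,
      trans (cong (_∩ P) top) (∩-identityˡ P) ,
      (λ i x∈ → x∈p∩q⁺ (steps i (p∩q⊆p _ _ x∈) , p∩q⊆q _ _ x∈)) ,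
      Monochromatic-⊆ (p∩q⊆p _ _) mono₀ , λ i → Monochromatic-⊆ ∩-─-⊆ (monoₛ i)
      where
      loops∩P : ∀ e → (e ∈ F zero ∩ P → LoopsIn M P e) × (LoopsIn M P e → e ∈ F zero ∩ P)
      loops∩P e = (λ e∈ → p∩q⊆q _ _ e∈ , proj₂ (proj₁ (loops e) (p∩q⊆p _ _ e∈))) ,
                  λ (e∈P , loop) → x∈p∩q⁺ (proj₂ (loops e) (∈⊤ , loop) , e∈P)

    TargetOn-empty : ∀ {G} → Empty G → TargetOn M c G
    TargetOn-empty {G} empty =
      0 , (λ _ → G) , (λ _ → ⊆-refl , λ e e∈G _ → contradiction (e , e∈G) empty) ,
      (λ e → (λ e∈G → contradiction (e , e∈G) empty) , λ (e∈G , _) → contradiction (e , e∈G) empty) ,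
      refl , (λ ()) , (λ x _ x∈G _ → contradiction (x , x∈G) empty) , λ ()

    TargetOn-extend : ∀ {G H} → IsFlat M G → IsFlat M H → H ⊆ G → Monochromatic M c (G ─ H) →
      TargetOn M c H → TargetOn M c G
    TargetOn-extend {G} {H} flatG flatH H⊆G mono (k , F , flats , loops , top , steps , mono₀ , monoₛ) =
      suc k , F′ , flats′ , loops′ , snoc-last F G , steps′ , mono₀ , monoₛ′
      where
      F′ : Fin (suc (suc k)) → Subset n
      F′ = snoc F G

      F′-inject₁ : ∀ i → F′ (inject₁ i) ≡ F i
      F′-inject₁ = snoc-inject₁ F G

      flats′ : ∀ i → IsFlatIn M G (F′ i)
      flats′ i with view i
      ... | ‵fromℕ     = subst (IsFlatIn M G) (sym (snoc-last F G)) (isFlat⇒isFlatIn flatG ⊆-refl)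
      ... | ‵inject₁ j = subst (IsFlatIn M G) (sym (F′-inject₁ j))
          (isFlat⇒isFlatIn (isFlatIn-isFlat⇒isFlat flatH (flats j)) (H⊆G ∘ proj₁ (flats j)))

      -- Loops lie in every flat, so those of G are already in H.
      loops′ : ∀ e → (e ∈ F zero → LoopsIn M G e) × (LoopsIn M G e → e ∈ F zero)
      loops′ e = (λ e∈ → let (e∈H , loop) = proj₁ (loops e) e∈ in H⊆G e∈H , loop) ,
                 λ (_ , loop) → proj₂ (loops e) (loop∈flat flatH loop , loop)

      steps′ : ∀ i → F′ (inject₁ i) ⊆ F′ (suc i)
      steps′ i with view i
      ... | ‵fromℕ     =
        subst₂ _⊆_ (sym (F′-inject₁ (fromℕ k))) (sym (snoc-last F G)) (subst (_⊆ G) (sym top) H⊆G)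
      ... | ‵inject₁ j = subst₂ _⊆_ (sym (F′-inject₁ (inject₁ j))) (sym (F′-inject₁ (suc j))) (steps j)

      monoₛ′ : ∀ i → Monochromatic M c (F′ (suc i) ─ F′ (inject₁ i))
      monoₛ′ i with view i
      ... | ‵fromℕ     = subst (Monochromatic M c)
        (sym (cong₂ _─_ (snoc-last F G) (trans (F′-inject₁ (fromℕ k)) top))) mono
      ... | ‵inject₁ j = subst (Monochromatic M c)
        (sym (cong₂ _─_ (F′-inject₁ (suc j)) (F′-inject₁ (inject₁ j)))) (monoₛ j)

module Layers {n : ℕ} (M : Matroid n) {C : Set} {c : Fin n → C} {P : Subset n} (W : TargetOn M c P) where
  open MatroidTheory M
  open Targets M using (chain; strata-monochromatic)

  private
    height : ℕ
    height = proj₁ W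

    F : Fin (suc height) → Subset n
    F = chain W

    flats : ∀ i → IsFlatIn M P (F i)
    flats = proj₁ (proj₂ (proj₂ W))

    top : F (fromℕ height) ≡ P
    top = proj₁ (proj₂ (proj₂ (proj₂ (proj₂ W))))

    steps : ∀ i → F (inject₁ i) ⊆ F (suc i)
    steps = proj₁ (proj₂ (proj₂ (proj₂ (proj₂ (proj₂ W)))))

  layer : Fin n → Fin (suc height)
  layer e = least (λ i → e ∈? F i)

  ∈F⇒layer≤ : ∀ {e i} → e ∈ F i → layer e Fin.≤ i
  ∈F⇒layer≤ {e} = least-minimal (λ i → e ∈? F i)

  ∈F-layer : ∀ {e} → e ∈ P → e ∈ F (layer e)
  ∈F-layer {e} e∈P = least-satisfies (λ i → e ∈? F i) (subst (e ∈_) (sym top) e∈P)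

  layer≤⇒∈F : ∀ {e i} → e ∈ P → layer e Fin.≤ i → e ∈ F i
  layer≤⇒∈F e∈P layer≤i = chain-mono F steps layer≤i (∈F-layer e∈P)

  ∈-stratum-layer : ∀ {e} → e ∈ P → e ∈ stratum F (layer e)
  ∈-stratum-layer e∈P = ∈-stratum (∈F-layer e∈P) ∈F⇒layer≤
    where
    ∈-stratum : ∀ {e i} → e ∈ F i → (∀ {j} → e ∈ F j → i Fin.≤ j) → e ∈ stratum F i
    ∈-stratum {i = zero}  e∈F _     = e∈F
    ∈-stratum {i = suc i} e∈F first =
      x∈p∧x∉q⇒x∈p─q e∈F (λ e∈F′ → <⇒≱ (Finₚ.≤̄⇒inject₁< Finₚ.≤-refl) (first e∈F′))

  layer-colour : ∀ {e e′} → e ∈ P → e′ ∈ P → layer e ≡ layer e′ → c e ≡ c e′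
  layer-colour {e} {e′} e∈P e′∈P same = strata-monochromatic W (layer e′) e e′
    (subst (λ i → e ∈ stratum F i) same (∈-stratum-layer e∈P)) (∈-stratum-layer e′∈P)

  spans⇒layer≤ : ∀ {X e} i → X ⊆ F i → e ∈ P → X spans e → layer e Fin.≤ i
  spans⇒layer≤ i X⊆F e∈P spans = ∈F⇒layer≤ (spans⇒∈ (proj₂ (flats i) _ e∈P) X⊆F spans)

  line-layer≤ : ∀ {x y u i} → x ∈ P → y ∈ P → u ∈ P → u ∈ line x y →
    layer x Fin.≤ i → layer y Fin.≤ i → layer u Fin.≤ i
  line-layer≤ x∈P y∈P u∈P u∈xy x≤i y≤i =
    spans⇒layer≤ _ (pair⊆ (layer≤⇒∈F x∈P x≤i) (layer≤⇒∈F y∈P y≤i)) u∈P (∈cl⁻ u∈xy)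

  line-layer : ∀ {x y u} → x ∈ P → y ∈ P → u ∈ P → layer x Fin.< layer y →
    u ∈ line x y → ¬ x ∥ u → layer u ≡ layer y
  line-layer {x} {y} {u} x∈P y∈P u∈P x<y u∈xy x∦u =
    Finₚ.≤-antisym (line-layer≤ x∈P y∈P u∈P u∈xy (<⇒≤ x<y) Finₚ.≤-refl) y≤u
    where
    y∈xu : y ∈ line x u
    y∈xu = line-exchange u∈xy x∦u

    y≤u : layer y Fin.≤ layer u
    y≤u with Finₚ.≤-total (layer x) (layer u)
    ... | inj₁ x≤u = line-layer≤ x∈P u∈P y∈P y∈xu x≤u Finₚ.≤-refl
    ... | inj₂ u≤x = contradiction (line-layer≤ x∈P u∈P y∈P y∈xu Finₚ.≤-refl u≤x) (<⇒≱ x<y)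

-- The backward direction for decidable colour equality

module Backward {n : ℕ} (M : Matroid n) (connected : Connected M) (modular : IsModular M)
  (rank≥3 : rankM M ≥ 3) {C : Set} (c : Fin n → C) (_≟_ : DecidableEquality C)
  (planeTarget : ∀ P → IsPlane M P → TargetOn M c P) where

  open MatroidTheory M
  open Targets M using (TargetOn-empty; TargetOn-extend)

  private
    2≤n : 2 ≤ n
    2≤n = ≤-trans (n≤1+n 2) (≤-trans rank≥3 (subst (r ⊤ ≤_) (∣⊤∣≡n n) (rank-≤-card M ⊤)))

  open Loopless (connected⇒loopless 2≤n connected)

  in-some-plane : ∀ {A : Set} x y z → (∀ {P} → IsPlane M P → x ∈ P → y ∈ P → z ∈ P → A) → A
  in-some-plane x y z k with plane-through rank≥3 x y z
  ... | _ , plane , x∈P , y∈P , z∈P = k plane x∈P y∈P z∈P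

  -- z ≺ x holds exactly when z lies in a lower layer than x in the target of any plane
  -- containing both (≺⇒layer< and layer<⇒≺), but its definition does not mention planes.
  infix 4 _≺_ _≺?_
  record _≺_ (z x : Fin n) : Set where
    field
      colour≢     : c z ≢ c x
      line-colour : ∀ {u} → u ∈ line z x → ¬ z ∥ u → c u ≡ c x
  open _≺_

  _≺?_ : ∀ z x → Dec (z ≺ x)
  z ≺? x = map′ (λ (c≢ , colours) → record { colour≢ = c≢ ; line-colour = λ {u} → colours u })
                (λ z≺x → colour≢ z≺x , λ u → line-colour z≺x)
                (¬? (c z ≟ c x) ×-dec Finₚ.all? λ u → u ∈? line z x →-dec ¬? (z ∥? u) →-dec c u ≟ c x)

  module InPlane {P} (plane : IsPlane M P) where
    open Layers M (planeTarget P plane) public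

    line⊆P : ∀ {x y} → x ∈ P → y ∈ P → line x y ⊆ P
    line⊆P x∈P y∈P = cl-minimal (proj₁ plane) (pair⊆ x∈P y∈P)

    ∥⇒layer≤ : ∀ {x y} → x ∈ P → y ∈ P → x ∥ y → layer y Fin.≤ layer x
    ∥⇒layer≤ x∈P y∈P x∥y = spans⇒layer≤ _ (⁅x⁆⊆ (layer≤⇒∈F x∈P Finₚ.≤-refl)) y∈P (∥⇒spans x∥y)

  ∥⇒colour≡ : ∀ {x y} → x ∥ y → c x ≡ c y
  ∥⇒colour≡ {x} {y} x∥y = in-some-plane x y y λ plane x∈P y∈P _ → let open InPlane plane in
    layer-colour x∈P y∈P (Finₚ.≤-antisym (∥⇒layer≤ y∈P x∈P (∥-sym x∥y)) (∥⇒layer≤ x∈P y∈P x∥y))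

  colour≢⇒∦ : ∀ {x y} → c x ≢ c y → ¬ x ∥ y
  colour≢⇒∦ c≢ = c≢ ∘ ∥⇒colour≡

  module _ {P} (plane : IsPlane M P) where
    open InPlane plane

    layer<⇒≺ : ∀ {z x} → z ∈ P → x ∈ P → c z ≢ c x → layer z Fin.< layer x → z ≺ x
    layer<⇒≺ z∈P x∈P c≢ z<x = record
      { colour≢     = c≢
      ; line-colour = λ u∈zx z∦u →
          layer-colour (line⊆P z∈P x∈P u∈zx) x∈P (line-layer z∈P x∈P (line⊆P z∈P x∈P u∈zx) z<x u∈zx z∦u)
      }

    -- A third point u of the line would share the layer, hence the colour, of z;
    -- but z ≺ x gives u the colour of x.
    ≺⇒layer≯ : ∀ {z x} → z ∈ P → x ∈ P → z ≺ x → ¬ layer x Fin.< layer z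
    ≺⇒layer≯ {z} {x} z∈P x∈P z≺x x<z =
      let x∦z = colour≢⇒∦ (colour≢ z≺x ∘ sym)
          u , u∈xz , x∦u , z∦u = lines-have-three-points connected modular x∦z
          u∈P = line⊆P x∈P z∈P u∈xz
      in colour≢ z≺x (begin
        c z ≡⟨ layer-colour z∈P u∈P (sym (line-layer x∈P z∈P u∈P x<z u∈xz x∦u)) ⟩
        c u ≡⟨ line-colour z≺x (subst (u ∈_) (line-comm x z) u∈xz) z∦u ⟩
        c x ∎)
      where open ≡-Reasoning

    ≺⇒layer< : ∀ {z x} → z ∈ P → x ∈ P → z ≺ x → layer z Fin.< layer x
    ≺⇒layer< {z} {x} z∈P x∈P z≺x = by-cases (Finₚ.<-cmp (layer z) (layer x))
      where
      by-cases : Tri (layer z Fin.< layer x) (layer z ≡ layer x) (layer x Fin.< layer z) →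
        layer z Fin.< layer x
      by-cases (tri< z<x _ _) = z<x
      by-cases (tri≈ _ z≡x _) = contradiction (layer-colour z∈P x∈P z≡x) (colour≢ z≺x)
      by-cases (tri> _ _ x<z) = contradiction x<z (≺⇒layer≯ z∈P x∈P z≺x)

    ≺-line-layer : ∀ {z x w} → z ∈ P → x ∈ P → z ≺ x → w ∈ line z x → ¬ z ∥ w → layer w ≡ layer x
    ≺-line-layer z∈P x∈P z≺x w∈zx z∦w =
      line-layer z∈P x∈P (line⊆P z∈P x∈P w∈zx) (≺⇒layer< z∈P x∈P z≺x) w∈zx z∦w

    ≺-or-≻-in : ∀ {x y} → x ∈ P → y ∈ P → c x ≢ c y → x ≺ y ⊎ y ≺ x
    ≺-or-≻-in {x} {y} x∈P y∈P c≢ = by-cases (Finₚ.<-cmp (layer x) (layer y))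
      where
      by-cases : Tri (layer x Fin.< layer y) (layer x ≡ layer y) (layer y Fin.< layer x) →
        x ≺ y ⊎ y ≺ x
      by-cases (tri< x<y _ _) = inj₁ (layer<⇒≺ x∈P y∈P c≢ x<y)
      by-cases (tri≈ _ x≡y _) = contradiction (layer-colour x∈P y∈P x≡y) c≢
      by-cases (tri> _ _ y<x) = inj₂ (layer<⇒≺ y∈P x∈P (c≢ ∘ sym) y<x)

    ≺-trans-in : ∀ {x y z} → x ∈ P → y ∈ P → z ∈ P → x ≺ y → y ≺ z → c x ≢ c z → x ≺ z
    ≺-trans-in x∈P y∈P z∈P x≺y y≺z c≢ =
      layer<⇒≺ x∈P z∈P c≢ (Finₚ.<-trans (≺⇒layer< x∈P y∈P x≺y) (≺⇒layer< y∈P z∈P y≺z))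

    ≺-from-line-in : ∀ {z x y u} → z ∈ P → x ∈ P → y ∈ P → z ≺ x → x ≺ y →
      u ∈ line z x → ¬ z ∥ u → u ≺ y
    ≺-from-line-in z∈P x∈P y∈P z≺x x≺y u∈zx z∦u =
      layer<⇒≺ (line⊆P z∈P x∈P u∈zx) y∈P (colour≢ x≺y ∘ trans (sym (line-colour z≺x u∈zx z∦u)))
        (subst (Fin._< _) (sym (≺-line-layer z∈P x∈P z≺x u∈zx z∦u)) (≺⇒layer< x∈P y∈P x≺y))

    ≺-to-line-in : ∀ {z′ z x w} → z′ ∈ P → z ∈ P → x ∈ P → z′ ≺ x → z ≺ x →
      w ∈ line z x → ¬ z ∥ w → z′ ≺ w
    ≺-to-line-in z′∈P z∈P x∈P z′≺x z≺x w∈zx z∦w =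
      layer<⇒≺ z′∈P (line⊆P z∈P x∈P w∈zx) (λ c≡ → colour≢ z′≺x (trans c≡ (line-colour z≺x w∈zx z∦w)))
        (subst (_ Fin.<_) (sym (≺-line-layer z∈P x∈P z≺x w∈zx z∦w)) (≺⇒layer< z′∈P x∈P z′≺x))

  ≺-or-≻ : ∀ {x y} → c x ≢ c y → x ≺ y ⊎ y ≺ x
  ≺-or-≻ {x} {y} c≢ = in-some-plane x y y λ plane x∈P y∈P _ → ≺-or-≻-in plane x∈P y∈P c≢

  ≺-trans : ∀ {x y z} → x ≺ y → y ≺ z → c x ≢ c z → x ≺ z
  ≺-trans {x} {y} {z} x≺y y≺z c≢ = in-some-plane x y z λ plane x∈P y∈P z∈P →
    ≺-trans-in plane x∈P y∈P z∈P x≺y y≺z c≢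

  ≺-from-line : ∀ {z x y u} → z ≺ x → x ≺ y → u ∈ line z x → ¬ z ∥ u → u ≺ y
  ≺-from-line {z} {x} {y} z≺x x≺y u∈zx z∦u = in-some-plane z x y λ plane z∈P x∈P y∈P →
    ≺-from-line-in plane z∈P x∈P y∈P z≺x x≺y u∈zx z∦u

  ≺-to-line : ∀ {z′ z x w} → z′ ≺ x → z ≺ x → w ∈ line z x → ¬ z ∥ w → z′ ≺ w
  ≺-to-line {z′} {z} {x} z′≺x z≺x w∈zx z∦w = in-some-plane z′ z x λ plane z′∈P z∈P x∈P →
    ≺-to-line-in plane z′∈P z∈P x∈P z′≺x z≺x w∈zx z∦w

  -- If z is not spanned by Y - z, the modular meet of cl (Y - z) with the line xz is a point w
  -- coloured like x with all of Y - z below it, and induction applies to w.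
  ∉cl-of-≺ : ∀ Y {x} → (∀ {z} → z ∈ Y → z ≺ x) → x ∉ cl Y
  ∉cl-of-≺ = removal-induction (λ Y → ∀ {x} → (∀ {z} → z ∈ Y → z ≺ x) → x ∉ cl Y)
    (λ empty _ x∈cl → empty-¬spans empty (∈cl⁻ x∈cl)) step
    where
    step : ∀ {Y z} → z ∈ Y → (∀ {x} → (∀ {z′} → z′ ∈ Y - z → z′ ≺ x) → x ∉ cl (Y - z)) →
           ∀ {x} → (∀ {z′} → z′ ∈ Y → z′ ≺ x) → x ∉ cl Y
    step {Y} {z} z∈Y ih {x} ≺x x∈clY with z ∈? cl (Y - z)
    ... | yes z∈cl =
      ih (≺x ∘ p─q⊆p Y ⁅ z ⁆) (cl-minimal (cl-isFlat _) (∪-least ⊆cl (⁅x⁆⊆ z∈cl) ∘ p⊆[p-x]∪⁅x⁆ Y z) x∈clY)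
    ... | no  z∉cl =
      ih (λ z′∈ → ≺-to-line (≺x (p─q⊆p Y ⁅ z ⁆ z′∈)) (≺x z∈Y) w∈zx z∦w) (p∩q⊆p _ _ w∈meet)
      where
      x∦z : ¬ x ∥ z
      x∦z = colour≢⇒∦ (colour≢ (≺x z∈Y) ∘ sym)

      meet : Nonempty (cl (Y - z) ∩ line x z)
      meet = line-meets-cl-rest modular x∈clY z∈Y x∦z

      w : Fin n
      w = proj₁ meet

      w∈meet : w ∈ cl (Y - z) ∩ line x z
      w∈meet = proj₂ meet

      w∈zx : w ∈ line z x
      w∈zx = subst (w ∈_) (line-comm x z) (p∩q⊆q _ _ w∈meet)

      z∦w : ¬ z ∥ w
      z∦w z∥w = z∉cl (∥-closed (cl-isFlat _) (p∩q⊆p _ _ w∈meet) (∥-sym z∥w))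

  below : Subset n → Fin n → Subset n
  below G x = select (λ z → (z ∈? G) ×-dec (z ≺? x))

  ∈below⁺ : ∀ {G x z} → z ∈ G → z ≺ x → z ∈ below G x
  ∈below⁺ {G} {x} z∈G z≺x = ∈-select⁺ (λ z → (z ∈? G) ×-dec (z ≺? x)) (z∈G , z≺x)

  ∈below⁻ : ∀ {G x z} → z ∈ below G x → z ∈ G × z ≺ x
  ∈below⁻ {G} {x} = ∈-select⁻ (λ z → (z ∈? G) ×-dec (z ≺? x))

  ∉cl-below : ∀ G x → x ∉ cl (below G x)
  ∉cl-below G x = ∉cl-of-≺ (below G x) (proj₂ ∘ ∈below⁻)

  -- If z and y have the same colour, a third point u of the line zx lies below y,
  -- and z is on the line through x and u.
  below⊆cl-below : ∀ {G x y} → IsFlat M G → x ∈ G → x ≺ y → below G x ⊆ cl (below G y)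
  below⊆cl-below {G} {x} {y} flatG x∈G x≺y {z} z∈ = by-colour (c z ≟ c y)
    where
    z∈G : z ∈ G
    z∈G = proj₁ (∈below⁻ z∈)

    z≺x : z ≺ x
    z≺x = proj₂ (∈below⁻ z∈)

    by-colour : Dec (c z ≡ c y) → z ∈ cl (below G y)
    by-colour (no c≢) = ⊆cl (∈below⁺ z∈G (≺-trans z≺x x≺y c≢))
    by-colour (yes _) =
      let u , u∈zx , z∦u , x∦u = lines-have-three-points connected modular (colour≢⇒∦ (colour≢ z≺x))
          u∈G = cl-minimal flatG (pair⊆ z∈G x∈G) u∈zx
      in cl-mono (pair⊆ (∈below⁺ x∈G x≺y) (∈below⁺ u∈G (≺-from-line z≺x x≺y u∈zx z∦u)))
                 (line-exchange (subst (u ∈_) (line-comm z x) u∈zx) x∦u)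

  rank-below-< : ∀ {G x y} → IsFlat M G → x ∈ G → x ≺ y → r (below G x) < r (below G y)
  rank-below-< {G} {x} {y} flatG x∈G x≺y = begin-strict
    r (below G x)             <⟨ ≰⇒> (∉cl-below G x ∘ ∈cl⁺) ⟩
    r (below G x ∪ ⁅ x ⁆)     ≤⟨ rank-mono M (∪-least (below⊆cl-below flatG x∈G x≺y) (⁅x⁆⊆ x∈cl)) ⟩
    r (cl (below G y))        ≡⟨ rank-cl _ ⟩
    r (below G y)             ∎
    where
    open ≤-Reasoning

    x∈cl : x ∈ cl (below G y)
    x∈cl = ⊆cl (∈below⁺ x∈G x≺y)

  ≺-maximal : ∀ {G x₀} → IsFlat M G → x₀ ∈ G → ∃ λ x → x ∈ G × (∀ {y} → y ∈ G → ¬ x ≺ y)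
  ≺-maximal {G} {x₀} flatG x₀∈G = x , x∈G , λ y∈G x≺y →
    <⇒≱ (rank-below-< flatG x∈G x≺y)
        (All.lookup (f[xs]≤f[argmax] x₀ elements) (∈-filter⁺ (_∈? G) (∈-allFin _) y∈G))
    where
    elements : List (Fin n)
    elements = filter (_∈? G) (allFin n)

    x : Fin n
    x = argmax (λ x → r (below G x)) x₀ elements

    x∈G : x ∈ G
    x∈G = argmax-all (λ x → r (below G x)) x₀∈G (all-filter (_∈? G) (allFin n))

  maximal⇒monochromatic : ∀ {G x} → x ∈ G → (∀ {y} → y ∈ G → ¬ x ≺ y) →
    Monochromatic M c (G ─ cl (below G x))
  maximal⇒monochromatic {G} {x} x∈G maximal e e′ e∈ e′∈ = trans (colour-x e∈) (sym (colour-x e′∈))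
    where
    colour-x : ∀ {e} → e ∈ G ─ cl (below G x) → c e ≡ c x
    colour-x {e} e∈ = decidable-stable (c e ≟ c x) λ c≢ →
      let e∈G , e∉cl = x∈p─q⁻ G _ e∈
      in [ (λ e≺x → e∉cl (⊆cl (∈below⁺ e∈G e≺x))) , maximal e∈G ]′ (≺-or-≻ c≢)

  flat⇒target : ∀ {G} → Acc _⊂_ G → IsFlat M G → TargetOn M c G
  flat⇒target {G} (acc smaller) flatG = by-cases (nonempty? G)
    where
    by-cases : Dec (Nonempty G) → TargetOn M c G
    by-cases (no empty)       = TargetOn-empty c empty
    by-cases (yes (_ , x₀∈G)) =
      let x , x∈G , maximal = ≺-maximal flatG x₀∈G
          H⊆G = cl-minimal flatG (proj₁ ∘ ∈below⁻)
      in TargetOn-extend c flatG (cl-isFlat _) H⊆G (maximal⇒monochromatic x∈G maximal)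
           (flat⇒target (smaller (H⊆G , x , x∈G , ∉cl-below G x)) (cl-isFlat _))

  target : Target M c
  target = flat⇒target (⊂-wellFounded ⊤) (λ _ e∉⊤ → contradiction ∈⊤ e∉⊤)

-- Reduction to decidable colour equality

module PlaneRecolouring {n : ℕ} (M : Matroid n) {C : Set} (c : Fin n → C)
  (planeTarget : ∀ P → IsPlane M P → TargetOn M c P) where

  open MatroidTheory M using (r)
  open Targets M using (SameStratum; sameStratum?; strata-monochromatic; recolour)

  isPlane? : ∀ P → Dec (IsPlane M P)
  isPlane? P = Finₚ.all? (λ e → ¬? (e ∈? P) →-dec r P <? r (P ∪ ⁅ e ⁆)) ×-dec r P ℕ.≟ 3

  -- A plane has many proofs of IsPlane, each with its own target; indexing by the
  -- decision isPlane? P fixes one of them.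
  SameStratumIn : ∀ P → Dec (IsPlane M P) → Fin n → Fin n → Set
  SameStratumIn P (yes plane) = SameStratum (planeTarget P plane)
  SameStratumIn P (no _)      = λ _ _ → Data.Empty.⊥

  sameStratumIn? : ∀ P d x y → Dec (SameStratumIn P d x y)
  sameStratumIn? P (yes plane) = sameStratum? (planeTarget P plane)
  sameStratumIn? P (no _)      = λ _ _ → no id

  sameStratumIn⇒colour≡ : ∀ {P d x y} → SameStratumIn P d x y → c x ≡ c y
  sameStratumIn⇒colour≡ {P} {yes plane} (i , x∈ , y∈) =
    strata-monochromatic (planeTarget P plane) i _ _ x∈ y∈

  SameStratumInPlane : Fin n → Fin n → Set
  SameStratumInPlane x y = Σ[ P ∈ Subset n ] SameStratumIn P (isPlane? P) x y

  private
    refinement : Σ[ d ∈ (Fin n → Fin n) ] FinerThan d c ×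
                 (∀ {x y} → SameStratumInPlane x y → d x ≡ d y)
    refinement = refinement-between c SameStratumInPlane
      (λ x y → anySubset? (λ P → sameStratumIn? P (isPlane? P) x y))
      (λ (P , same) → sameStratumIn⇒colour≡ {P} {isPlane? P} same)

  c′ : Fin n → Fin n
  c′ = proj₁ refinement

  c′-finer : FinerThan c′ c
  c′-finer = proj₁ (proj₂ refinement)

  planeTarget′ : ∀ P → IsPlane M P → TargetOn M c′ P
  planeTarget′ P plane = from-decision (isPlane? P) (λ same → proj₂ (proj₂ refinement) (P , same))
    where
    from-decision : (d : Dec (IsPlane M P)) → (∀ {x y} → SameStratumIn P d x y → c′ x ≡ c′ y) →
      TargetOn M c′ P
    from-decision (yes plane′) joins =
      recolour (planeTarget P plane′) (λ i x y x∈ y∈ → joins (i , x∈ , y∈))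
    from-decision (no ¬plane)  _     = contradiction plane ¬plane

theorem7p8 : {n : ℕ} {C : Set} (M : Matroid n) (c : Fin n → C) →
    Connected M → IsModular M → rankM M ≥ 3 →
    (Target M c → (∀ (P : Subset n) → IsPlane M P → TargetOn M c P)) ×
    ((∀ (P : Subset n) → IsPlane M P → TargetOn M c P) → Target M c)
theorem7p8 M c connected modular rank≥3 =
  (λ target P _ → Targets.Target⇒TargetOn M c target P) ,
  λ planeTarget → let open PlaneRecolouring M c planeTarget in
    Targets.TargetOn-coarsen M c′-finer
      (Backward.target M connected modular rank≥3 c′ Finₚ._≟_ planeTarget′)
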